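{- Let $G$ be a graph and $r\ge2$ an integer. Let $X\subseteq V(G)$ and let $W\in\mathcal W_r(X)$ be a walk that uses exactly $\ell$ vertices of $X$. Then the endvertices of $W$ have distance at most $(\ell-1)r/2$ in $G$.
   Context: Graphs are simple. A short cycle is a cycle of length $\le r$. An $X$-path is a path with at least one edge whose endvertices lie in $X$ and whose other vertices do not. An $r$-local $X$-path is an $X$-path contained in some short cycle, or one consisting of a single edge with both ends in $X$. $\mathcal W_r(X)$ is the set of all walks that are concatenations of $r$-local $X$-paths and repeat no vertex of $X$. -}

module Defs where

open import Data.Nat using (ℕ; suc; _≤_; _*_; _∸_)
open import Data.Fin using (Fin)
open import Data.Fin.Subset using (Subset; _∈_; _∉_)
open import Data.Fin.Subset.Properties using (_∈?_)
open import Data.List using (List; []; _∷_; _++_; length; head; last; filter; concatMap; drop)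
open import Data.List.Relation.Unary.All using (All)
open import Data.List.Relation.Unary.Linked using (Linked)
open import Data.List.Relation.Unary.Unique.Propositional using (Unique)
open import Data.Maybe using (just)
open import Data.Product using (Σ; ∃; _×_; _,_)
open import Data.Sum using (_⊎_)
open import Relation.Nullary using (¬_)
open import Relation.Binary.PropositionalEquality using (_≡_; _≢_)

record Graph : Set₁ where
  field
    n     : ℕ
    Adj   : Fin n → Fin n → Set
    sym   : ∀ {u v} → Adj u v → Adj v u
    irref : ∀ {v} → ¬ Adj v v

module _ (G : Graph) where
  open Graph G

  V : Set
  V = Fin n

  IsWalk : List V → Set
  IsWalk w = w ≢ [] × Linked Adj w

  IsPath : List V → Set
  IsPath p = IsWalk p × Unique p

  edges : List V → ℕ
  edges w = length w ∸ 1

  data Consec : List V → V → V → Set where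
    here  : ∀ {x y xs} → Consec (x ∷ y ∷ xs) x y
    there : ∀ {x xs a b} → Consec xs a b → Consec (x ∷ xs) a b

  IsCycle : List V → Set
  IsCycle [] = Data.Empty.⊥ where import Data.Empty
  IsCycle (c ∷ cs) = 3 ≤ length (c ∷ cs) × Unique (c ∷ cs) × Linked Adj (c ∷ cs ++ c ∷ [])

  CycleEdge : List V → V → V → Set
  CycleEdge [] a b = Data.Empty.⊥ where import Data.Empty
  CycleEdge (c ∷ cs) a b = Consec (c ∷ cs ++ c ∷ []) a b ⊎ Consec (c ∷ cs ++ c ∷ []) b a

  ShortCycle : ℕ → List V → Set
  ShortCycle r c = IsCycle c × length c ≤ r

  PathInCycle : List V → List V → Set
  PathInCycle p c = ∀ {a b} → Consec p a b → CycleEdge c a b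

  XPath : Subset n → List V → Set
  XPath X p = IsPath p × Σ V λ x → Σ V λ y → Σ (List V) λ inner →
                p ≡ x ∷ inner ++ y ∷ [] × x ∈ X × y ∈ X × All (_∉ X) inner

  LocalXPath : ℕ → Subset n → List V → Set
  LocalXPath r X p = XPath X p ×
    ((Σ (List V) λ c → ShortCycle r c × PathInCycle p c)
     ⊎ (Σ V λ x → Σ V λ y → p ≡ x ∷ y ∷ [] × x ∈ X × y ∈ X))

  glue : List (List V) → List V
  glue [] = []
  glue (p ∷ ps) = p ++ concatMap (drop 1) ps

  Xocc : Subset n → List V → List V
  Xocc X w = filter (_∈? X) w

  InW : ℕ → Subset n → List V → Set
  InW r X w = Σ (List (List V)) λ ps →
    ps ≢ [] × All (LocalXPath r X) ps ×
    Linked (λ p q → last p ≡ head q) ps ×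
    w ≡ glue ps × Unique (Xocc X w)

  DistLe : V → V → ℕ → Set
  DistLe a b d = Σ (List V) λ p → IsPath p × head p ≡ just a × last p ≡ just b × edges p ≤ d

-- Each r-local X-path has endpoints at distance at most r/2: a single edge
-- has length 1 ≤ r/2, and two vertices of a cycle of length ≤ r split it into
-- two walks of total length ≤ r, one of which has length ≤ r/2.  A walk in
-- 𝒲_r(X) glued from k such paths meets X at least k + 1 times, so ℓ ≥ k + 1
-- and concatenating the k short walks gives an end-to-end walk of length at
-- most k r/2 ≤ (ℓ - 1) r/2, which shortcuts to a path.
module Submission where

open import Defs
open import Data.Nat using (ℕ; _≤_; _*_; _∸_)
open import Data.Fin.Subset using (Subset)
open import Data.List using (List; length; head; last)
open import Data.Maybe using (just)
open import Data.Product using (Σ; _×_)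
open import Relation.Binary.PropositionalEquality using (_≡_)

open import Data.Nat using (suc; _+_; z≤n; s≤s)
open import Data.Nat.Properties
  using (≤-refl; ≤-trans; n≤1+n; m≤m+n; ≤-reflexive; ≤-total; +-comm; +-identityʳ; +-monoʳ-≤; +-mono-≤; m≤n+m; m∸n≤m; *-monoˡ-≤; *-distribˡ-+)
open import Data.Nat.Tactic.RingSolver using (solve-∀)
open import Data.Fin using (_≟_)
open import Data.Fin.Subset.Properties using (_∈?_)
open import Data.List using ([]; _∷_; _++_; concatMap; drop)
open import Data.List.Properties using (length-++; ++-assoc; filter-++; filter-accept)
open import Data.List.Relation.Unary.All using (All; []; _∷_)
import Data.List.Relation.Unary.All as All
open import Data.List.Relation.Unary.All.Properties.Core using (¬Any⇒All¬)
open import Data.List.Relation.Unary.Any using (here; there)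
open import Data.List.Relation.Unary.Linked using (Linked; [-]; _∷_)
import Data.List.Relation.Unary.Linked as Linked
open import Data.List.Relation.Unary.Unique.Propositional using (Unique)
open import Data.List.Relation.Unary.AllPairs using ([]; _∷_)
import Data.List.Membership.Propositional as List
open import Data.List.Membership.Propositional.Properties using (∈-∃++; ∈-++⁻)
import Data.List.Membership.DecPropositional as DecMembership
open import Data.Maybe.Properties using (just-injective)
open import Data.Product using (_,_; proj₁; proj₂)
open import Data.Sum using (inj₁; inj₂)
open import Relation.Nullary using (yes; no)
open import Relation.Binary.PropositionalEquality using (refl; sym; trans; cong; subst; module ≡-Reasoning)

module _ {A : Set} where

  last-++-∷ : ∀ (P : List A) {y S} → last (P ++ y ∷ S) ≡ last (y ∷ S)
  last-++-∷ []          = refl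
  last-++-∷ (_ ∷ [])    = refl
  last-++-∷ (_ ∷ q ∷ P) = last-++-∷ (q ∷ P)

  Linked-++⁻ʳ : ∀ {R : A → A → Set} P {S} → Linked R (P ++ S) → Linked R S
  Linked-++⁻ʳ []      l = l
  Linked-++⁻ʳ (_ ∷ P) l = Linked-++⁻ʳ P (Linked.tail l)

  Unique-++⁻ʳ : ∀ (P : List A) {S} → Unique (P ++ S) → Unique S
  Unique-++⁻ʳ []      u       = u
  Unique-++⁻ʳ (_ ∷ P) (_ ∷ u) = Unique-++⁻ʳ P u

double-≤ : ∀ {m n} → m ≤ n → 2 * m ≤ m + n
double-≤ {m} {n} m≤n = subst (_≤ m + n) (cong (m +_) (sym (+-identityʳ m))) (+-monoʳ-≤ m m≤n)

module _ (G : Graph) where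
  open Graph G renaming (sym to Adj-sym)
  open DecMembership (_≟_ {n}) using () renaming (_∈?_ to _∈ᴸ?_)

  data Walk : V G → V G → ℕ → Set where
    ε   : ∀ {x} → Walk x x 0
    _◅_ : ∀ {x y z k} → Adj x y → Walk y z k → Walk x z (suc k)

  infixr 5 _◅_ _◅◅_

  _◅◅_ : ∀ {x y z j k} → Walk x y j → Walk y z k → Walk x z (j + k)
  ε        ◅◅ w′ = w′
  (a ◅ w) ◅◅ w′ = a ◅ (w ◅◅ w′)

  reverse : ∀ {x y k} → Walk x y k → Walk y x k
  reverse ε                 = ε
  reverse {k = suc k} (a ◅ w) = subst (Walk _ _) (+-comm k 1) (reverse w ◅◅ Adj-sym a ◅ ε)

  DistLe-suffix : ∀ {p} P {x S y k} → p ≡ P ++ x ∷ S → IsPath G p → last p ≡ just y → edges G p ≤ k →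
                  DistLe G x y k
  DistLe-suffix P {x} {S} refl ((_ , lk) , un) lt len =
    x ∷ S , (((λ ()) , Linked-++⁻ʳ P lk) , Unique-++⁻ʳ P un) , refl ,
    trans (sym (last-++-∷ P)) lt , ≤-trans (edges-suffix P) len
    where
      edges-suffix : ∀ P → length S ≤ edges G (P ++ x ∷ S)
      edges-suffix []      = ≤-refl
      edges-suffix (_ ∷ P) = ≤-trans (edges-suffix P) (m∸n≤m _ 1)

  -- A walk x ◅ w is shortened by cutting the path obtained from w at x, if x lies on it.
  walk⇒distLe : ∀ {x y k} → Walk x y k → DistLe G x y k
  walk⇒distLe {x} ε = x ∷ [] , (((λ ()) , [-]) , [] ∷ []) , refl , refl , z≤n
  walk⇒distLe {x} (x~c ◅ w) with walk⇒distLe w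
  ... | p , path , hd , lt , len with x ∈ᴸ? p
  walk⇒distLe {x} (x~c ◅ w) | [] , _ , () , _ | no _
  walk⇒distLe {x} (x~c ◅ w) | c ∷ L , ((_ , lk) , un) , refl , lt , len | no x∉p =
    x ∷ c ∷ L , (((λ ()) , x~c ∷ lk) , ¬Any⇒All¬ _ x∉p ∷ un) , refl , lt , s≤s len
  walk⇒distLe {x} (x~c ◅ w) | p , path , _ , lt , len | yes x∈p =
    let P , S , p≡P++x∷S = ∈-∃++ {v = x} {xs = p} x∈p
    in DistLe-suffix P p≡P++x∷S path lt (≤-trans len (n≤1+n _))

  HalfWalk : ℕ → V G → V G → Set
  HalfWalk m x y = Σ ℕ λ e → Walk x y e × 2 * e ≤ m

  HalfWalk-mono : ∀ {m m′ x y} → m ≤ m′ → HalfWalk m x y → HalfWalk m′ x y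
  HalfWalk-mono m≤m′ (e , w , 2e≤m) = e , w , ≤-trans 2e≤m m≤m′

  HalfWalk-reverse : ∀ {m x y} → HalfWalk m x y → HalfWalk m y x
  HalfWalk-reverse (e , w , 2e≤m) = e , reverse w , 2e≤m

  HalfWalk-++ : ∀ {m m′ x y z} → HalfWalk m x y → HalfWalk m′ y z → HalfWalk (m + m′) x z
  HalfWalk-++ {m} {m′} (e , w , 2e≤m) (e′ , w′ , 2e′≤m′) =
    e + e′ , w ◅◅ w′ , subst (_≤ m + m′) (sym (*-distribˡ-+ 2 e e′)) (+-mono-≤ 2e≤m 2e′≤m′)

  shorter-of-round-trip : ∀ {x y e e′} → Walk x y e → Walk y x e′ → HalfWalk (e + e′) x y
  shorter-of-round-trip {e = e} {e′} w w′ with ≤-total e e′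
  ... | inj₁ e≤e′ = e  , w , double-≤ e≤e′
  ... | inj₂ e′≤e = e′ , reverse w′ , subst (2 * e′ ≤_) (+-comm e′ e) (double-≤ e′≤e)

  prefix-walk : ∀ {u T} P {x} S → Linked Adj (u ∷ T) → u ∷ T ≡ P ++ x ∷ S → Walk u x (length P)
  prefix-walk []          S _          refl = ε
  prefix-walk (_ ∷ [])    S (u~x ∷ _)  refl = u~x ◅ ε
  prefix-walk (_ ∷ q ∷ P) S (u~q ∷ l)  refl = u~q ◅ prefix-walk (q ∷ P) S l refl

  segment-walk : ∀ {L} P {x} Q {y} R → Linked Adj L → L ≡ P ++ x ∷ Q ++ y ∷ R → Walk x y (suc (length Q))
  segment-walk P Q R l refl = prefix-walk (_ ∷ Q) R (Linked-++⁻ʳ P l) refl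

  closedWalk-halfWalk-ordered : ∀ {c₀ cs} P {x} Q {y} R → Linked Adj (c₀ ∷ cs ++ c₀ ∷ []) →
                     c₀ ∷ cs ≡ P ++ x ∷ Q ++ y ∷ R → HalfWalk (length (c₀ ∷ cs)) x y
  closedWalk-halfWalk-ordered {c₀} {cs} P {x} Q {y} R closed c≡ =
    HalfWalk-mono (≤-reflexive round-trip-length) (shorter-of-round-trip x→y (y→c₀ ◅◅ c₀→x))
    where
      open ≡-Reasoning
      closed≡ : c₀ ∷ cs ++ c₀ ∷ [] ≡ P ++ x ∷ Q ++ y ∷ R ++ c₀ ∷ []
      closed≡ = begin
        (c₀ ∷ cs) ++ c₀ ∷ []              ≡⟨ cong (_++ c₀ ∷ []) c≡ ⟩
        (P ++ x ∷ Q ++ y ∷ R) ++ c₀ ∷ []  ≡⟨ ++-assoc P _ _ ⟩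
        P ++ x ∷ (Q ++ y ∷ R) ++ c₀ ∷ []  ≡⟨ cong (λ t → P ++ x ∷ t) (++-assoc Q _ _) ⟩
        P ++ x ∷ Q ++ y ∷ R ++ c₀ ∷ []    ∎
      x→y : Walk x y (suc (length Q))
      x→y = segment-walk P Q (R ++ c₀ ∷ []) closed closed≡
      y→c₀ : Walk y c₀ (suc (length R))
      y→c₀ = segment-walk (P ++ x ∷ Q) R [] closed (trans closed≡ (sym (++-assoc P (x ∷ Q) _)))
      c₀→x : Walk c₀ x (length P)
      c₀→x = prefix-walk P (Q ++ y ∷ R ++ c₀ ∷ []) closed closed≡
      rearrange : ∀ p q r → suc q + (suc r + p) ≡ p + suc (q + suc r)
      rearrange = solve-∀
      round-trip-length : suc (length Q) + (suc (length R) + length P) ≡ length (c₀ ∷ cs)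
      round-trip-length = begin
        suc (length Q) + (suc (length R) + length P)  ≡⟨ rearrange (length P) (length Q) (length R) ⟩
        length P + suc (length Q + suc (length R))    ≡⟨ cong (λ t → length P + suc t) (length-++ Q) ⟨
        length P + length (x ∷ Q ++ y ∷ R)            ≡⟨ length-++ P ⟨
        length (P ++ x ∷ Q ++ y ∷ R)                  ≡⟨ cong length c≡ ⟨
        length (c₀ ∷ cs)                              ∎

  closedWalk-halfWalk : ∀ {c₀ cs x y} → Linked Adj (c₀ ∷ cs ++ c₀ ∷ []) →
                        x List.∈ c₀ ∷ cs → y List.∈ c₀ ∷ cs → HalfWalk (length (c₀ ∷ cs)) x y
  closedWalk-halfWalk {c₀} {cs} {x} {y} closed x∈c y∈c with ∈-∃++ {v = x} {xs = c₀ ∷ cs} x∈c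
  ... | A , B , c≡ with ∈-++⁻ A (subst (y List.∈_) c≡ y∈c)
  ... | inj₂ (here refl) = 0 , ε , z≤n
  ... | inj₂ (there y∈B) =
    let B₁ , B₂ , B≡ = ∈-∃++ {v = y} {xs = B} y∈B
    in closedWalk-halfWalk-ordered A B₁ B₂ closed (trans c≡ (cong (λ t → A ++ x ∷ t) B≡))
  ... | inj₁ y∈A =
    let A₁ , A₂ , A≡ = ∈-∃++ {v = y} {xs = A} y∈A
    in HalfWalk-reverse (closedWalk-halfWalk-ordered A₁ A₂ B closed
         (trans c≡ (trans (cong (_++ x ∷ B) A≡) (++-assoc A₁ _ _))))

  Consec⇒∈ : ∀ {L a b} → Consec G L a b → a List.∈ L × b List.∈ L
  Consec⇒∈ here      = here refl , there (here refl)
  Consec⇒∈ (there c) = let a∈ , b∈ = Consec⇒∈ c in there a∈ , there b∈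

  CycleEdge⇒∈ : ∀ {c a b} → CycleEdge G c a b → a List.∈ c × b List.∈ c
  CycleEdge⇒∈ {[]} ()
  CycleEdge⇒∈ {c₀ ∷ cs} (inj₁ ab) = let a∈ , b∈ = Consec⇒∈ ab in ∈-closed a∈ , ∈-closed b∈
    where
      ∈-closed : ∀ {z} → z List.∈ c₀ ∷ cs ++ c₀ ∷ [] → z List.∈ c₀ ∷ cs
      ∈-closed z∈ with ∈-++⁻ (c₀ ∷ cs) z∈
      ... | inj₁ z∈c         = z∈c
      ... | inj₂ (here refl) = here refl
  CycleEdge⇒∈ {c₀ ∷ cs} (inj₂ ba) = let b∈ , a∈ = CycleEdge⇒∈ {c₀ ∷ cs} (inj₁ ba) in a∈ , b∈

  Consec-first : ∀ x inner y → Σ (V G) λ z → Consec G (x ∷ inner ++ y ∷ []) x z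
  Consec-first x []      y = y , here
  Consec-first x (i ∷ _) y = i , here

  Consec-last : ∀ x inner y → Σ (V G) λ z → Consec G (x ∷ inner ++ y ∷ []) z y
  Consec-last x []          y = x , here
  Consec-last x (i ∷ inner) y = let z , c = Consec-last i inner y in z , there c

  localXPath-halfWalk : ∀ {r X x inner y} → 2 ≤ r → LocalXPath G r X (x ∷ inner ++ y ∷ []) → HalfWalk r x y
  localXPath-halfWalk _ (_ , inj₁ ([] , (() , _) , _))
  localXPath-halfWalk {x = x} {inner} {y} _ (_ , inj₁ (c@(_ ∷ _) , ((_ , _ , closed) , |c|≤r) , p⊆c)) =
    HalfWalk-mono |c|≤r (closedWalk-halfWalk closed x∈c y∈c)
    where
      x∈c : x List.∈ c
      x∈c = proj₁ (CycleEdge⇒∈ (p⊆c (proj₂ (Consec-first x inner y))))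
      y∈c : y List.∈ c
      y∈c = proj₂ (CycleEdge⇒∈ (p⊆c (proj₂ (Consec-last x inner y))))
  localXPath-halfWalk {inner = []}        2≤r ((((_ , x~y ∷ _) , _) , _) , inj₂ _) = 1 , x~y ◅ ε , 2≤r
  localXPath-halfWalk {inner = _ ∷ []}    _   (_ , inj₂ (_ , _ , () , _))
  localXPath-halfWalk {inner = _ ∷ _ ∷ _} _   (_ , inj₂ (_ , _ , () , _))

  last-glue : ∀ x inner y qs →
              last (glue G ((x ∷ inner ++ y ∷ []) ∷ qs)) ≡ last (y ∷ concatMap (drop 1) qs)
  last-glue x inner y qs =
    trans (cong last (++-assoc (x ∷ inner) (y ∷ []) _)) (last-++-∷ (x ∷ inner))

  glue-halfWalk : ∀ {r X a b} → 2 ≤ r → ∀ ps → All (LocalXPath G r X) ps →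
                  Linked (λ p q → last p ≡ head q) ps →
                  head (glue G ps) ≡ just a → last (glue G ps) ≡ just b → HalfWalk (length ps * r) a b
  glue-halfWalk _ [] _ _ () _
  glue-halfWalk {r} 2≤r (_ ∷ []) (lp@((_ , x , y , inner , refl , _) , _) ∷ []) _ refl lb
    with just-injective (trans (sym (last-glue x inner y [])) lb)
  ... | refl = HalfWalk-mono (m≤m+n r 0) (localXPath-halfWalk 2≤r lp)
  glue-halfWalk 2≤r (_ ∷ q ∷ qs) (lp@((_ , x , y , inner , refl , _) , _) ∷ lq@((_ , _ , _ , _ , refl , _) , _) ∷ lqs)
                (p~q ∷ joined) refl lb
    with just-injective (trans (sym (last-++-∷ (x ∷ inner))) p~q)
  ... | refl = HalfWalk-++ (localXPath-halfWalk 2≤r lp)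
                 (glue-halfWalk 2≤r (q ∷ qs) (lq ∷ lqs) joined refl (trans (sym (last-glue x inner y (q ∷ qs))) lb))

  Xocc-++ : ∀ X A B → length (Xocc G X (A ++ B)) ≡ length (Xocc G X A) + length (Xocc G X B)
  Xocc-++ X A B = trans (cong length (filter-++ (_∈? X) A B)) (length-++ (Xocc G X A))

  XPath-Xocc-tail : ∀ {X p} → XPath G X p → 1 ≤ length (Xocc G X (drop 1 p))
  XPath-Xocc-tail {X} (_ , _ , y , inner , refl , _ , y∈X , _) =
    subst (1 ≤_) (sym (Xocc-++ X inner (y ∷ [])))
      (subst (λ t → 1 ≤ length (Xocc G X inner) + length t) (sym (filter-accept (_∈? X) y∈X)) (m≤n+m 1 _))

  Xocc-tails : ∀ {X ps} → All (XPath G X) ps → length ps ≤ length (Xocc G X (concatMap (drop 1) ps))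
  Xocc-tails [] = z≤n
  Xocc-tails {X} {p ∷ _} (xp ∷ xps) =
    subst (_ ≤_) (sym (Xocc-++ X (drop 1 p) _)) (+-mono-≤ (XPath-Xocc-tail xp) (Xocc-tails xps))

  Xocc-glue : ∀ {X ps} → All (XPath G X) ps → length ps ≤ length (Xocc G X (glue G ps)) ∸ 1
  Xocc-glue [] = z≤n
  Xocc-glue {X} (xp@(_ , _ , _ , _ , refl , x∈X , _) ∷ xps) =
    subst (λ t → _ ≤ length t ∸ 1) (sym (filter-accept (_∈? X) x∈X)) (Xocc-tails (xp ∷ xps))

lemma5p4 : (G : Graph) (r : ℕ) → 2 ≤ r → (X : Subset (Graph.n G)) →
    (w : List (V G)) → InW G r X w → (ℓ : ℕ) → length (Xocc G X w) ≡ ℓ →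
    (a b : V G) → head w ≡ just a → last w ≡ just b →
    Σ ℕ λ d → DistLe G a b d × 2 * d ≤ (ℓ ∸ 1) * r
lemma5p4 G r 2≤r _ _ (ps , _ , local , joined , refl , _) _ refl _ _ ha lb =
  let e , walk , 2e≤|ps|r = glue-halfWalk G 2≤r ps local joined ha lb
  in e , walk⇒distLe G walk , ≤-trans 2e≤|ps|r (*-monoˡ-≤ r (Xocc-glue G (All.map proj₁ local)))
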